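{- For all closed terms $P$ and $Q$ over $\Sigma_{CP}(A)$: if $\mathrm{CP}_{rp}\vdash P=Q$ then $P=_{rp}Q$.
   Context: Fix a finite non-empty set $A$ of atomic propositions. Closed terms are built from $T$, $F$, $a\in A$ by conditional composition $P\triangleleft Q\triangleright R$. $\mathrm{CP}_{rp}$ consists of (CP1) $x\triangleleft T\triangleright y=x$, (CP2) $x\triangleleft F\triangleright y=y$, (CP3) $T\triangleleft x\triangleright F=x$, (CP4) $x\triangleleft(y\triangleleft z\triangleright u)\triangleright v=(x\triangleleft y\triangleright v)\triangleleft z\triangleright(x\triangleleft u\triangleright v)$, and for every $a\in A$: (CPrp1) $(x\triangleleft a\triangleright y)\triangleleft a\triangleright z=(x\triangleleft a\triangleright x)\triangleleft a\triangleright z$, (CPrp2) $x\triangleleft a\triangleright(y\triangleleft a\triangleright z)=x\triangleleft a\triangleright(z\triangleleft a\triangleright z)$; $\vdash$ is equational derivability. A reactive valuation algebra (RVA) is a set $RV$ with elements $T_{RV},F_{RV}$ and for each $a\in A$ functions $y_a:RV\to\{T,F\}$, $\partial_a:RV\to RV$ with $y_a(T_{RV})=T$, $y_a(F_{RV})=F$, $\partial_a(T_{RV})=T_{RV}$, $\partial_a(F_{RV})=F_{RV}$. For closed $P$ and $H\in RV$: $T/H=T$, $F/H=F$, $a/H=y_a(H)$, $\partial_T(H)=\partial_F(H)=H$; $(P\triangleleft Q\triangleright R)/H=P/\partial_Q(H)$ and $\partial_{P\triangleleft Q\triangleright R}(H)=\partial_P(\partial_Q(H))$ if $Q/H=T$,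 and $R/\partial_Q(H)$ resp. $\partial_R(\partial_Q(H))$ if $Q/H=F$. The variety $rp$ (repetition-proof valuations) is the class of RVAs with $y_a(\partial_a(H))=y_a(H)$ for all $a\in A$, $H\in RV$. $P\equiv_{rp}Q$ means $P/H=Q/H$ for all RVAs in $rp$ and all $H$; $=_{rp}$ is the largest congruence (w.r.t. conditional composition) on closed terms contained in $\equiv_{rp}$. -}

module Defs where

open import Data.Nat using (ℕ; suc)
open import Data.Fin using (Fin)
open import Data.Bool using (Bool; true; false)
open import Data.Empty using (⊥; ⊥-elim)
open import Data.Product using (Σ; _×_; _,_)
open import Relation.Binary.PropositionalEquality using (_≡_)

Atom : ℕ → Set
Atom n = Fin (suc n)

data Term (n : ℕ) (V : Set) : Set where
  T F  : Term n V
  atom : Atom n → Term n V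
  var  : V → Term n V
  _◁_▷_ : Term n V → Term n V → Term n V → Term n V

Closed : ℕ → Set
Closed n = Term n ⊥

OTerm : ℕ → Set
OTerm n = Term n ℕ

sub : ∀ {n V W} → (V → Term n W) → Term n V → Term n W
sub σ T = T
sub σ F = F
sub σ (atom a) = atom a
sub σ (var v) = σ v
sub σ (x ◁ y ▷ z) = sub σ x ◁ sub σ y ▷ sub σ z

embed : ∀ {n} → Closed n → OTerm n
embed = sub (λ ())

x y z u v : ∀ {n} → OTerm n
x = var 0
y = var 1
z = var 2
u = var 3
v = var 4

data CPrpAx {n : ℕ} : OTerm n → OTerm n → Set where
  CP1 : CPrpAx (x ◁ T ▷ y) x
  CP2 : CPrpAx (x ◁ F ▷ y) y
  CP3 : CPrpAx (T ◁ x ▷ F) x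
  CP4 : CPrpAx (x ◁ (y ◁ z ▷ u) ▷ v) ((x ◁ y ▷ v) ◁ z ▷ (x ◁ u ▷ v))
  CPrp1 : (a : Atom n) →
          CPrpAx ((x ◁ atom a ▷ y) ◁ atom a ▷ z) ((x ◁ atom a ▷ x) ◁ atom a ▷ z)
  CPrp2 : (a : Atom n) →
          CPrpAx (x ◁ atom a ▷ (y ◁ atom a ▷ z)) (x ◁ atom a ▷ (z ◁ atom a ▷ z))

infix 4 CPrp⊢_≈_
data CPrp⊢_≈_ {n : ℕ} : OTerm n → OTerm n → Set where
  ax    : ∀ {s t} (σ : ℕ → OTerm n) → CPrpAx s t → CPrp⊢ sub σ s ≈ sub σ t
  refl  : ∀ {s} → CPrp⊢ s ≈ s
  sym   : ∀ {s t} → CPrp⊢ s ≈ t → CPrp⊢ t ≈ s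
  trans : ∀ {s t r} → CPrp⊢ s ≈ t → CPrp⊢ t ≈ r → CPrp⊢ s ≈ r
  cong  : ∀ {s s' t t' r r'} → CPrp⊢ s ≈ s' → CPrp⊢ t ≈ t' → CPrp⊢ r ≈ r' →
          CPrp⊢ (s ◁ t ▷ r) ≈ (s' ◁ t' ▷ r')

record RVA (n : ℕ) : Set₁ where
  field
    RV   : Set
    T-RV F-RV : RV
    yv   : Atom n → RV → Bool
    ∂    : Atom n → RV → RV
    yT   : ∀ a → yv a T-RV ≡ true
    yF   : ∀ a → yv a F-RV ≡ false
    ∂T   : ∀ a → ∂ a T-RV ≡ T-RV
    ∂F   : ∀ a → ∂ a F-RV ≡ F-RV

module _ {n : ℕ} (R : RVA n) where
  open RVA R

  eval : Closed n → RV → Bool × RV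
  eval T H = true , H
  eval F H = false , H
  eval (atom a) H = yv a H , ∂ a H
  eval (var ()) H
  eval (P ◁ Q ▷ S) H with eval Q H
  ... | true  , H' = eval P H'
  ... | false , H' = eval S H'

  reply : Closed n → RV → Bool
  reply P H = Data.Product.proj₁ (eval P H)

  deriv : Closed n → RV → RV
  deriv P H = Data.Product.proj₂ (eval P H)

IsRP : ∀ {n} → RVA n → Set
IsRP R = ∀ a H → yv a (∂ a H) ≡ yv a H
  where open RVA R

_≡rp_ : ∀ {n} → Closed n → Closed n → Set₁
_≡rp_ {n} P Q = (R : RVA n) → IsRP R → ∀ H → reply R P H ≡ reply R Q H

record IsCongruence {n : ℕ} (_∼_ : Closed n → Closed n → Set₁) : Set₁ where
  field
    c-refl  : ∀ {P} → P ∼ P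
    c-sym   : ∀ {P Q} → P ∼ Q → Q ∼ P
    c-trans : ∀ {P Q S} → P ∼ Q → Q ∼ S → P ∼ S
    c-cong  : ∀ {P P' Q Q' S S'} → P ∼ P' → Q ∼ Q' → S ∼ S' →
              (P ◁ Q ▷ S) ∼ (P' ◁ Q' ▷ S')

-- =_rp: the largest congruence contained in ≡_rp.  P =rp Q holds iff
-- some congruence contained in ≡_rp relates P and Q (the largest such
-- congruence contains every such congruence).
_=rp_ : ∀ {n} → Closed n → Closed n → Set₂
_=rp_ {n} P Q = Σ (Closed n → Closed n → Set₁) λ _∼_ →
  IsCongruence _∼_ × (∀ {P' Q'} → P' ∼ Q' → P' ≡rp Q') × (P ∼ Q)

-- Soundness is proved for a finer relation than =rp: two closed terms are
-- identified when they produce the same reply AND the same derivative on every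
-- valuation of every repetition-proof RVA.  Because a conditional continues
-- with the derivative of its condition, this relation is a congruence; it is
-- contained in ≡rp, so it is below the largest such congruence =rp.  Each
-- axiom instance is valid for it (CPrp1/CPrp2 exactly because y_a ∘ ∂_a = y_a),
-- and validity is preserved by the rules of equational logic.
module Submission where

open import Defs
open import Data.Nat using (ℕ)
open import Data.Bool using (Bool; true; false)
open import Data.Product using (_×_; _,_; proj₁)
open import Relation.Binary.PropositionalEquality as ≡ using (_≡_; subst₂)
open ≡.≡-Reasoning

module _ {n : ℕ} (R : RVA n) where
  open RVA R

  branch : Closed n → Closed n → Bool × RV → Bool × RV
  branch P S (true  , H) = eval R P H
  branch P S (false , H) = eval R S H

  eval-◁▷ : ∀ P Q S H → eval R (P ◁ Q ▷ S) H ≡ branch P S (eval R Q H)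
  eval-◁▷ P Q S H with eval R Q H
  ... | true  , _ = ≡.refl
  ... | false , _ = ≡.refl

  branch-cong : ∀ {P P' S S'} → (∀ H → eval R P H ≡ eval R P' H) →
                (∀ H → eval R S H ≡ eval R S' H) →
                ∀ r → branch P S r ≡ branch P' S' r
  branch-cong eP eS (true  , H) = eP H
  branch-cong eP eS (false , H) = eS H

  branch-T-F : ∀ r → branch T F r ≡ r
  branch-T-F (true  , _) = ≡.refl
  branch-T-F (false , _) = ≡.refl

  branch-branch : ∀ P Q U V r →
                  branch P V (branch Q U r) ≡ branch (P ◁ Q ▷ V) (P ◁ U ▷ V) r
  branch-branch P Q U V (true  , H) = ≡.sym (eval-◁▷ P Q V H)
  branch-branch P Q U V (false , H) = ≡.sym (eval-◁▷ P U V H)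

infix 4 _≋rp_
_≋rp_ : ∀ {n} → Closed n → Closed n → Set₁
_≋rp_ {n} P Q = (R : RVA n) → IsRP R → ∀ H → eval R P H ≡ eval R Q H

≋rp⇒≡rp : ∀ {n} {P Q : Closed n} → P ≋rp Q → P ≡rp Q
≋rp⇒≡rp P≋Q R rp H = ≡.cong proj₁ (P≋Q R rp H)

≋rp-cong : ∀ {n} {P P' Q Q' S S' : Closed n} → P ≋rp P' → Q ≋rp Q' → S ≋rp S' →
           P ◁ Q ▷ S ≋rp P' ◁ Q' ▷ S'
≋rp-cong {P = P} {P'} {Q} {Q'} {S} {S'} P≋ Q≋ S≋ R rp H = begin
  eval R (P ◁ Q ▷ S) H         ≡⟨ eval-◁▷ R P Q S H ⟩
  branch R P S (eval R Q H)    ≡⟨ ≡.cong (branch R P S) (Q≋ R rp H) ⟩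
  branch R P S (eval R Q' H)   ≡⟨ branch-cong R (P≋ R rp) (S≋ R rp) (eval R Q' H) ⟩
  branch R P' S' (eval R Q' H) ≡⟨ ≡.sym (eval-◁▷ R P' Q' S' H) ⟩
  eval R (P' ◁ Q' ▷ S') H      ∎

≋rp-isCongruence : ∀ {n} → IsCongruence (_≋rp_ {n})
≋rp-isCongruence = record
  { c-refl  = λ R rp H → ≡.refl
  ; c-sym   = λ P≋Q R rp H → ≡.sym (P≋Q R rp H)
  ; c-trans = λ P≋Q Q≋S R rp H → ≡.trans (P≋Q R rp H) (Q≋S R rp H)
  ; c-cong  = λ {P} {P'} {Q} {Q'} {S} {S'} → ≋rp-cong {P = P} {P'} {Q} {Q'} {S} {S'}
  }

axiom-sound : ∀ {n} {s t : OTerm n} → CPrpAx s t →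
              (ρ : ℕ → Closed n) → sub ρ s ≋rp sub ρ t
axiom-sound CP1 ρ R rp H = ≡.refl
axiom-sound CP2 ρ R rp H = ≡.refl
axiom-sound CP3 ρ R rp H = begin
  eval R (T ◁ ρ 0 ▷ F) H       ≡⟨ eval-◁▷ R T (ρ 0) F H ⟩
  branch R T F (eval R (ρ 0) H) ≡⟨ branch-T-F R (eval R (ρ 0) H) ⟩
  eval R (ρ 0) H               ∎
axiom-sound CP4 ρ R rp H = begin
  eval R (P ◁ (Q ◁ Z ▷ U) ▷ V) H            ≡⟨ eval-◁▷ R P (Q ◁ Z ▷ U) V H ⟩
  branch R P V (eval R (Q ◁ Z ▷ U) H)       ≡⟨ ≡.cong (branch R P V) (eval-◁▷ R Q Z U H) ⟩
  branch R P V (branch R Q U (eval R Z H))  ≡⟨ branch-branch R P Q U V (eval R Z H) ⟩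
  branch R (P ◁ Q ▷ V) (P ◁ U ▷ V) (eval R Z H) ≡⟨ ≡.sym (eval-◁▷ R (P ◁ Q ▷ V) Z (P ◁ U ▷ V) H) ⟩
  eval R ((P ◁ Q ▷ V) ◁ Z ▷ (P ◁ U ▷ V)) H  ∎
  where P = ρ 0; Q = ρ 1; Z = ρ 2; U = ρ 3; V = ρ 4
axiom-sound (CPrp1 a) ρ R rp H with RVA.yv R a H in yaH
... | false = ≡.refl
... | true rewrite rp a H | yaH = ≡.refl
axiom-sound (CPrp2 a) ρ R rp H with RVA.yv R a H in yaH
... | true = ≡.refl
... | false rewrite rp a H | yaH = ≡.refl

sub-sub : ∀ {n U V W} (ρ : V → Term n W) (σ : U → Term n V) (s : Term n U) →
          sub ρ (sub σ s) ≡ sub (λ i → sub ρ (σ i)) s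
sub-sub ρ σ T = ≡.refl
sub-sub ρ σ F = ≡.refl
sub-sub ρ σ (atom a) = ≡.refl
sub-sub ρ σ (var i) = ≡.refl
sub-sub ρ σ (p ◁ q ▷ r)
  rewrite sub-sub ρ σ p | sub-sub ρ σ q | sub-sub ρ σ r = ≡.refl

sub-embed : ∀ {n} (ρ : ℕ → Closed n) (P : Closed n) → sub ρ (embed P) ≡ P
sub-embed ρ T = ≡.refl
sub-embed ρ F = ≡.refl
sub-embed ρ (atom a) = ≡.refl
sub-embed ρ (p ◁ q ▷ r)
  rewrite sub-embed ρ p | sub-embed ρ q | sub-embed ρ r = ≡.refl

derivation-sound : ∀ {n} {s t : OTerm n} → CPrp⊢ s ≈ t →
                   (ρ : ℕ → Closed n) → sub ρ s ≋rp sub ρ t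
derivation-sound (ax {s} {t} σ s=t) ρ
  rewrite sub-sub ρ σ s | sub-sub ρ σ t = axiom-sound s=t (λ i → sub ρ (σ i))
derivation-sound refl ρ R rp H = ≡.refl
derivation-sound (sym d) ρ R rp H = ≡.sym (derivation-sound d ρ R rp H)
derivation-sound (trans d e) ρ R rp H =
  ≡.trans (derivation-sound d ρ R rp H) (derivation-sound e ρ R rp H)
derivation-sound (cong {s} {s'} {t} {t'} {r} {r'} d e f) ρ =
  ≋rp-cong {P = sub ρ s} {sub ρ s'} {sub ρ t} {sub ρ t'} {sub ρ r} {sub ρ r'}
    (derivation-sound d ρ) (derivation-sound e ρ) (derivation-sound f ρ)

mainTheorem5 : ∀ (n : ℕ) (P Q : Closed n) → CPrp⊢ embed P ≈ embed Q → P =rp Q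
mainTheorem5 n P Q d = _≋rp_ , ≋rp-isCongruence , (λ {P' Q'} → ≋rp⇒≡rp {P = P'} {Q'}) , P≋Q
  where
  ρ : ℕ → Closed n
  ρ _ = T

  P≋Q : P ≋rp Q
  P≋Q = subst₂ _≋rp_ (sub-embed ρ P) (sub-embed ρ Q) (derivation-sound d ρ)
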